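{- Let $N \equiv 14 \pmod{16}$. Let $EOOE$, $EEOE$, $OEEE$, $OOOO$, $EOEO$, $EEEO$ denote the numbers of partitions of $N$ into exactly two part sizes lying in the respective parity classes. Then $$EOOE + EEOE + OEEE + OOOO + EOEO + EEEO \equiv 0 \pmod 4.$$
   Context: A partition with exactly two part sizes is written $(\lambda_1^{m_1}\lambda_2^{m_2})$ with $\lambda_1>\lambda_2\ge1$ the part sizes and $m_1,m_2\ge1$ their multiplicities. Its parity class is the word $ABCD$ over $\{O,E\}$ where $A,B,C,D$ record whether $\lambda_1, m_1, \lambda_2, m_2$ respectively are odd ($O$) or even ($E$). -}

module Defs where

open import Data.Nat using (ℕ; zero; suc; _+_; _*_; _<?_; _≟_; _%_)
open import Data.Nat.Properties using ()
open import Data.Bool using (Bool; true; false; _∧_; if_then_else_)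
open import Data.List using (List; []; _∷_; map; concatMap; length; filter; upTo)
open import Data.Product using (_×_; _,_)
open import Relation.Nullary.Decidable using (⌊_⌋)

data Par : Set where
  O E : Par

parity : ℕ → Par
parity n with n % 2
... | zero = E
... | suc _ = O

_≟P_ : Par → Par → Bool
O ≟P O = true
E ≟P E = true
_ ≟P _ = false

-- A partition with exactly two part sizes (λ₁^m₁ λ₂^m₂), λ₁ > λ₂ ≥ 1,
-- m₁, m₂ ≥ 1, is determined by the quadruple (λ₁ , m₁ , λ₂ , m₂).
Quad : Set
Quad = ℕ × ℕ × ℕ × ℕ

range1 : ℕ → List ℕ
range1 n = map suc (upTo n)

-- all quadruples with entries in [1 .. N]  (every component of a
-- two-part-size partition of N is at most N)
candidates : ℕ → List Quad
candidates N =
  concatMap (λ a → concatMap (λ b → concatMap (λ c → map (λ d → (a , b , c , d))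
    (range1 N)) (range1 N)) (range1 N)) (range1 N)

isTwoSize : ℕ → Quad → Bool
isTwoSize N (l₁ , m₁ , l₂ , m₂) = ⌊ l₂ <? l₁ ⌋ ∧ ⌊ l₁ * m₁ + l₂ * m₂ ≟ N ⌋

twoSizePartitions : ℕ → List Quad
twoSizePartitions N = filter (λ q → isTwoSize N q Data.Bool.≟ true) (candidates N)

inClass : Par → Par → Par → Par → Quad → Bool
inClass A B C D (l₁ , m₁ , l₂ , m₂) =
  (parity l₁ ≟P A) ∧ (parity m₁ ≟P B) ∧ (parity l₂ ≟P C) ∧ (parity m₂ ≟P D)

count : Par → Par → Par → Par → ℕ → ℕ
count A B C D N =
  length (filter (λ q → inClass A B C D q Data.Bool.≟ true) (twoSizePartitions N))

module Submission where

-- Call the two-size partitions of N in the classes OOOO, EEOE, OEEE primal and those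
-- in EOOE, EOEO, EEEO dual; conjugation of Ferrers diagrams exchanges the two kinds.
-- The primal partitions carry an involution β: view a partition as two rectangles
-- (part size × multiplicity) and transpose both, an odd × even rectangle l × m
-- becoming m/2 × 2l instead.  Inside OOOO this breaks down for equal multiplicities,
-- (l + 2(k+1))^m l^m, where β swaps l and k instead, and for the squares (p^r r^p),
-- which β exchanges with the diagonal cases l = k.  The congruence N ≡ 14 (mod 16)
-- keeps the images primal (via N ≡ 2 (mod 4)) and rules out fixed points (they would
-- force N ≡ 2 (mod 8) or N ≡ 2, 6 (mod 16)).  Conjugation on primal and β ∘ conjugation
-- on dual partitions then generate a free ℤ/4-action, so the sum of the six counts is
-- divisible by 4.

open import Defs
open import Data.Bool using (Bool; true; false; _∧_; if_then_else_)
import Data.Bool as Bool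
open import Data.Empty using (⊥-elim)
open import Data.List using (List; []; _∷_; _++_; length; filter; map; concatMap; cartesianProduct)
open import Data.List.Membership.Propositional using (_∈_)
open import Data.List.Membership.Propositional.Properties
  using (∈-filter⁺; ∈-filter⁻; ∈-map⁺; ∈-map⁻; ∈-upTo⁺; ∈-cartesianProduct⁺; ∈-cartesianProduct⁻)
open import Data.List.Properties using (filter-all; map-cong; concatMap-cong; map-∘; map-++; map-id)
open import Data.List.Relation.Unary.Any using (here; there)
import Data.List.Relation.Unary.All as All
open import Data.List.Relation.Unary.Unique.Propositional using (Unique; _∷_)
import Data.List.Relation.Unary.Unique.Propositional.Properties as Unique
open import Data.Nat hiding (parity)
open import Data.Nat.DivMod using ([m+kn]%n≡m%n; m∣n⇒o%n%m≡o%m)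
open import Data.Nat.Divisibility using (_∣_; divides; _∣0; ∣m∣n⇒∣m+n; ∣-refl; n∣m⇒m%n≡0)
open import Data.Nat.Induction using (<-wellFounded)
open import Data.Nat.ListAction using (sum)
open import Data.Nat.Properties
open import Algebra.Properties.CommutativeSemigroup +-commutativeSemigroup using (interchange)
open import Data.Nat.Tactic.RingSolver using (solve-∀)
open import Data.Product using (_×_; _,_; proj₁; proj₂; ∃-syntax)
open import Data.Product.Properties using (≡-dec)
open import Data.Sum using (_⊎_; inj₁; inj₂)
open import Function using (id; _∘_)
open import Induction.WellFounded using (Acc; acc)
open import Relation.Binary.Definitions using (DecidableEquality; Tri; tri<; tri≈; tri>)
open import Relation.Binary.PropositionalEquality
open import Relation.Nullary using (¬_; ¬?; yes; no; does; contradiction)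
open import Relation.Nullary.Decidable using (dec-true; dec-false; _×-dec_)

infixl 6 _⊕_

_⊕_ : Par → Par → Par
E ⊕ p = p
O ⊕ E = O
O ⊕ O = E

⊕-cancelʳ : ∀ p q → p ⊕ q ⊕ q ≡ p
⊕-cancelʳ O O = refl
⊕-cancelʳ O E = refl
⊕-cancelʳ E O = refl
⊕-cancelʳ E E = refl

parity-suc : ∀ n → parity (suc n) ≡ O ⊕ parity n
parity-suc zero          = refl
parity-suc (suc zero)    = refl
parity-suc (suc (suc n)) = parity-suc n

parity-+ : ∀ m n → parity (m + n) ≡ parity m ⊕ parity n
parity-+ zero          n = refl
parity-+ (suc zero)    n = parity-suc n
parity-+ (suc (suc m)) n = parity-+ m n

parity-∸ : ∀ {m n} → n ≤ m → parity (m ∸ n) ≡ parity m ⊕ parity n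
parity-∸ {m} {n} n≤m = begin
  parity (m ∸ n)                        ≡⟨ ⊕-cancelʳ (parity (m ∸ n)) (parity n) ⟨
  parity (m ∸ n) ⊕ parity n ⊕ parity n  ≡⟨ cong (_⊕ parity n) (parity-+ (m ∸ n) n) ⟨
  parity (m ∸ n + n) ⊕ parity n         ≡⟨ cong (λ k → parity k ⊕ parity n) (m∸n+n≡m n≤m) ⟩
  parity m ⊕ parity n                   ∎
  where open ≡-Reasoning

parity-2* : ∀ k → parity (2 * k) ≡ E
parity-2* zero = refl
parity-2* (suc k) rewrite +-suc k (k + 0) = parity-2* k

parity-1+2* : ∀ k → parity (suc (2 * k)) ≡ O
parity-1+2* k = trans (parity-suc (2 * k)) (cong (O ⊕_) (parity-2* k))

2*≢1+2* : ∀ a b → 2 * a ≢ suc (2 * b)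
2*≢1+2* a b eq with () ← trans (sym (parity-2* a)) (trans (cong parity eq) (parity-1+2* b))

even⇒ : ∀ n → parity n ≡ E → ∃[ k ] n ≡ 2 * k
even⇒ zero          _ = 0 , refl
even⇒ (suc zero)    ()
even⇒ (suc (suc n)) e with even⇒ n e
... | k , refl = suc k , cong suc (sym (+-suc k (k + 0)))

odd⇒ : ∀ n → parity n ≡ O → ∃[ k ] n ≡ suc (2 * k)
odd⇒ zero          ()
odd⇒ (suc zero)    _ = 0 , refl
odd⇒ (suc (suc n)) o with odd⇒ n o
... | k , refl = suc k , cong (suc ∘ suc) (sym (+-suc k (k + 0)))

data ParityView : ℕ → Set where
  even : ∀ k → ParityView (2 * k)
  odd  : ∀ k → ParityView (suc (2 * k))

parityView : ∀ n → ParityView n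
parityView n with parity n in eq
... | E with k , refl ← even⇒ n eq = even k
... | O with k , refl ← odd⇒ n eq = odd k

odd⇒pos : ∀ {n} → parity n ≡ O → 0 < n
odd⇒pos {suc _} _ = z<s

⌊2*n/2⌋≡n : ∀ n → ⌊ 2 * n /2⌋ ≡ n
⌊2*n/2⌋≡n zero = refl
⌊2*n/2⌋≡n (suc n) rewrite +-suc n (n + 0) = cong suc (⌊2*n/2⌋≡n n)

⌊1+2*n/2⌋≡n : ∀ n → ⌊ suc (2 * n) /2⌋ ≡ n
⌊1+2*n/2⌋≡n zero = refl
⌊1+2*n/2⌋≡n (suc n) rewrite +-suc n (n + 0) = cong suc (⌊1+2*n/2⌋≡n n)

odd⇒1+2*⌊n/2⌋ : ∀ {n} → parity n ≡ O → suc (2 * ⌊ n /2⌋) ≡ n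
odd⇒1+2*⌊n/2⌋ {n} o with k , refl ← odd⇒ n o = cong (suc ∘ (2 *_)) (⌊1+2*n/2⌋≡n k)

odd-square : ∀ u → ∃[ t ] suc (2 * u) * suc (2 * u) ≡ 1 + t * 8
odd-square u with parityView u
... | even g = 2 * g * g + g , lemma g
  where
  lemma : ∀ g → suc (2 * (2 * g)) * suc (2 * (2 * g)) ≡ 1 + (2 * g * g + g) * 8
  lemma = solve-∀
... | odd g = 2 * g * g + 3 * g + 1 , lemma g
  where
  lemma : ∀ g → suc (2 * suc (2 * g)) * suc (2 * suc (2 * g)) ≡ 1 + (2 * g * g + 3 * g + 1) * 8
  lemma = solve-∀

ind : Bool → ℕ
ind b = if b then 1 else 0

module Counting {A : Set} where

  -- Written exactly as in Defs.count, so that counts unfold to it.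
  #[_] : (A → Bool) → List A → ℕ
  #[ f ] xs = length (filter (λ x → f x Bool.≟ true) xs)

  #-∷ : ∀ f x xs → #[ f ] (x ∷ xs) ≡ ind (f x) + #[ f ] xs
  #-∷ f x xs with f x
  ... | true  = refl
  ... | false = refl

  sum-map-+ : ∀ {B : Set} (u v : B → ℕ) ys →
              sum (map (λ y → u y + v y) ys) ≡ sum (map u ys) + sum (map v ys)
  sum-map-+ u v []       = refl
  sum-map-+ u v (y ∷ ys) = trans (cong (u y + v y +_) (sum-map-+ u v ys))
                                 (interchange (u y) (v y) (sum (map u ys)) (sum (map v ys)))

  #-sum : ∀ (fs : List (A → Bool)) g → (∀ x → sum (map (λ f → ind (f x)) fs) ≡ ind (g x)) →
          ∀ xs → sum (map (λ f → #[ f ] xs) fs) ≡ #[ g ] xs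
  #-sum fs g pointwise []       = sum-map-0 fs
    where
    sum-map-0 : ∀ {B : Set} (ys : List B) → sum (map (λ _ → 0) ys) ≡ 0
    sum-map-0 []       = refl
    sum-map-0 (_ ∷ ys) = sum-map-0 ys
  #-sum fs g pointwise (x ∷ xs) = begin
    sum (map (λ f → #[ f ] (x ∷ xs)) fs)
      ≡⟨ cong sum (map-cong (λ f → #-∷ f x xs) fs) ⟩
    sum (map (λ f → ind (f x) + #[ f ] xs) fs)
      ≡⟨ sum-map-+ (λ f → ind (f x)) (λ f → #[ f ] xs) fs ⟩
    sum (map (λ f → ind (f x)) fs) + sum (map (λ f → #[ f ] xs) fs)
      ≡⟨ cong₂ _+_ (pointwise x) (#-sum fs g pointwise xs) ⟩
    ind (g x) + #[ g ] xs
      ≡⟨ #-∷ g x xs ⟨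
    #[ g ] (x ∷ xs)
      ∎
    where open ≡-Reasoning

open Counting

-- Free ℤ/4-actions

module Freeℤ₄Action {A : Set} (_≟_ : DecidableEquality A) (σ : A → A) where

  σ³ : A → A
  σ³ x = σ (σ (σ x))

  record IsFreeℤ₄Action (xs : List A) : Set where
    field
      closed  : ∀ {x} → x ∈ xs → σ x ∈ xs
      period  : ∀ {x} → x ∈ xs → σ³ (σ x) ≡ x
      σ²-free : ∀ {x} → x ∈ xs → σ (σ x) ≢ x

    σ-free : ∀ {x} → x ∈ xs → σ x ≢ x
    σ-free x∈ σx≡x = σ²-free x∈ (trans (cong σ σx≡x) σx≡x)

    σ-injective : ∀ {x y} → x ∈ xs → y ∈ xs → σ x ≡ σ y → x ≡ y
    σ-injective x∈ y∈ eq = trans (sym (period x∈)) (trans (cong σ³ eq) (period y∈))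

  open IsFreeℤ₄Action

  remove : A → List A → List A
  remove z = filter (λ y → ¬? (y ≟ z))

  ∈-remove⁺ : ∀ {y z xs} → y ∈ xs → y ≢ z → y ∈ remove z xs
  ∈-remove⁺ {z = z} = ∈-filter⁺ (λ y → ¬? (y ≟ z))

  ∈-remove⁻ : ∀ {y z xs} → y ∈ remove z xs → y ∈ xs × y ≢ z
  ∈-remove⁻ {z = z} = ∈-filter⁻ (λ y → ¬? (y ≟ z))

  remove-unique : ∀ {z xs} → Unique xs → Unique (remove z xs)
  remove-unique {z} = Unique.filter⁺ (λ y → ¬? (y ≟ z))

  length-remove : ∀ {z xs} → Unique xs → z ∈ xs → length xs ≡ suc (length (remove z xs))
  length-remove {z} {y ∷ ys} (y∉ys ∷ _) (here refl) with y ≟ y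
  ... | no y≢y = contradiction refl y≢y
  ... | yes _  = cong (suc ∘ length) (sym (filter-all (λ y → ¬? (y ≟ z)) (All.map (_∘ sym) y∉ys)))
  length-remove {z} {y ∷ ys} u@(_ ∷ ys!) (there z∈) with y ≟ z
  ... | yes refl = contradiction z∈ (Unique.Unique[x∷xs]⇒x∉xs u)
  ... | no _     = cong suc (length-remove ys! z∈)

  ∈-tail : ∀ {x y : A} {ys} → y ∈ x ∷ ys → y ≢ x → y ∈ ys
  ∈-tail (here y≡x) y≢x = contradiction y≡x y≢x
  ∈-tail (there y∈) _   = y∈

  restrict : ∀ {xs ys} → (∀ {y} → y ∈ ys → y ∈ xs) → (∀ {y} → y ∈ ys → σ y ∈ ys) →
             IsFreeℤ₄Action xs → IsFreeℤ₄Action ys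
  restrict ys⊆xs closed′ act = record
    { closed  = closed′
    ; period  = period act ∘ ys⊆xs
    ; σ²-free = σ²-free act ∘ ys⊆xs
    }

  remove-orbit : ∀ {x ys} → Unique (x ∷ ys) → IsFreeℤ₄Action (x ∷ ys) →
                 ∃[ rest ] length ys ≡ 3 + length rest × Unique rest × IsFreeℤ₄Action rest
  remove-orbit {x} {ys} u@(_ ∷ ys!) act =
    rest , len , remove-unique (remove-unique (remove-unique ys!)) , restrict (there ∘ ∈ys) closed′ act
    where
    x∈ : x ∈ x ∷ ys
    x∈ = here refl
    x₁∈ = closed act x∈
    x₂∈ = closed act x₁∈
    x₃∈ = closed act x₂∈
    r₁ = remove (σ x) ys
    r₂ = remove (σ (σ x)) r₁
    rest = remove (σ³ x) r₂
    x₁∈ys : σ x ∈ ys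
    x₁∈ys = ∈-tail x₁∈ (σ-free act x∈)
    x₂∈r₁ : σ (σ x) ∈ r₁
    x₂∈r₁ = ∈-remove⁺ (∈-tail x₂∈ (σ²-free act x∈)) (σ-free act x₁∈)
    x₃∈r₂ : σ³ x ∈ r₂
    x₃∈r₂ = ∈-remove⁺ (∈-remove⁺ (∈-tail x₃∈ x₃≢x) (σ²-free act x₁∈)) (σ-free act x₂∈)
      where
      x₃≢x : σ³ x ≢ x
      x₃≢x x₃≡x = σ-free act x∈ (trans (cong σ (sym x₃≡x)) (period act x∈))
    len : length ys ≡ 3 + length rest
    len = trans (length-remove ys! x₁∈ys)
         (cong suc (trans (length-remove (remove-unique ys!) x₂∈r₁)
         (cong suc (length-remove (remove-unique (remove-unique ys!)) x₃∈r₂))))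
    ∈ys : ∀ {y} → y ∈ rest → y ∈ ys
    ∈ys = proj₁ ∘ ∈-remove⁻ ∘ proj₁ ∘ ∈-remove⁻ ∘ proj₁ ∘ ∈-remove⁻
    closed′ : ∀ {y} → y ∈ rest → σ y ∈ rest
    closed′ {y} y∈ = ∈-remove⁺ (∈-remove⁺ (∈-remove⁺ σy∈ys (avoid x∈ y≢x)) (avoid x₁∈ y≢x₁)) (avoid x₂∈ y≢x₂)
      where
      y∈₃ = ∈-remove⁻ y∈
      y∈₂ = ∈-remove⁻ (proj₁ y∈₃)
      y∈₁ = ∈-remove⁻ (proj₁ y∈₂)
      y∈xs : y ∈ x ∷ ys
      y∈xs = there (proj₁ y∈₁)
      y≢x : y ≢ x
      y≢x refl = Unique.Unique[x∷xs]⇒x∉xs u (proj₁ y∈₁)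
      y≢x₁ = proj₂ y∈₁
      y≢x₂ = proj₂ y∈₂
      y≢x₃ = proj₂ y∈₃
      avoid : ∀ {z} → z ∈ x ∷ ys → y ≢ z → σ y ≢ σ z
      avoid z∈ y≢z = y≢z ∘ σ-injective act y∈xs z∈
      σy∈ys : σ y ∈ ys
      σy∈ys = ∈-tail (closed act y∈xs) (λ σy≡x → avoid x₃∈ y≢x₃ (trans σy≡x (sym (period act x∈))))

  4∣length : ∀ xs → Unique xs → IsFreeℤ₄Action xs → 4 ∣ length xs
  4∣length xs = go xs (<-wellFounded (length xs))
    where
    go : ∀ xs → Acc _<_ (length xs) → Unique xs → IsFreeℤ₄Action xs → 4 ∣ length xs
    go []       _         _ _   = 4 ∣0
    go (x ∷ ys) (acc rec) u act with rest , len , rest! , act′ ← remove-orbit u act rewrite len =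
      ∣m∣n⇒∣m+n ∣-refl (go rest (rec (m<n+m (length rest) z<s)) rest! act′)

data Side : Set where
  primal dual neither : Side

module ℤ₄FromInvolutions {A : Set} (Valid : A → Set) (side : A → Side) (κ β : A → A) where

  On : Side → A → Set
  On s x = Valid x × side x ≡ s

  Paired : A → Set
  Paired x = On primal x ⊎ On dual x

  σ : A → A
  σ x with side x
  ... | primal  = κ x
  ... | dual    = β (κ x)
  ... | neither = x

  σ-primal : ∀ {x} → side x ≡ primal → σ x ≡ κ x
  σ-primal eq rewrite eq = refl

  σ-dual : ∀ {x} → side x ≡ dual → σ x ≡ β (κ x)
  σ-dual eq rewrite eq = refl

  record Involutions : Set where
    field
      κ-primal     : ∀ {x} → On primal x → On dual (κ x)
      κ-dual       : ∀ {x} → On dual x → On primal (κ x)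
      κ-involutive : ∀ {x} → Valid x → κ (κ x) ≡ x
      β-primal     : ∀ {x} → On primal x → On primal (β x)
      β-involutive : ∀ {x} → On primal x → β (β x) ≡ x
      β-free       : ∀ {x} → On primal x → β x ≢ x

  module _ (H : Involutions) where
    open Involutions H
    open ≡-Reasoning

    σ²-primal : ∀ {x} → On primal x → σ (σ x) ≡ β x
    σ²-primal {x} p@(v , eq) = begin
      σ (σ x)      ≡⟨ cong σ (σ-primal eq) ⟩
      σ (κ x)      ≡⟨ σ-dual (proj₂ (κ-primal p)) ⟩
      β (κ (κ x))  ≡⟨ cong β (κ-involutive v) ⟩
      β x          ∎

    σ²-dual : ∀ {x} → On dual x → σ (σ x) ≡ κ (β (κ x))
    σ²-dual {x} d@(_ , eq) = begin
      σ (σ x)      ≡⟨ cong σ (σ-dual eq) ⟩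
      σ (β (κ x))  ≡⟨ σ-primal (proj₂ (β-primal (κ-dual d))) ⟩
      κ (β (κ x))  ∎

    σ-closed : ∀ {x} → Paired x → Paired (σ x)
    σ-closed (inj₁ p) = inj₂ (subst (On dual) (sym (σ-primal (proj₂ p))) (κ-primal p))
    σ-closed (inj₂ d) = inj₁ (subst (On primal) (sym (σ-dual (proj₂ d))) (β-primal (κ-dual d)))

    σ⁴ : ∀ {x} → Paired x → σ (σ (σ (σ x))) ≡ x
    σ⁴ {x} (inj₁ p) = begin
      σ (σ (σ (σ x)))  ≡⟨ cong (σ ∘ σ) (σ²-primal p) ⟩
      σ (σ (β x))      ≡⟨ σ²-primal (β-primal p) ⟩
      β (β x)          ≡⟨ β-involutive p ⟩
      x                ∎
    σ⁴ {x} (inj₂ d) = begin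
      σ (σ (σ (σ x)))          ≡⟨ cong (σ ∘ σ) (σ²-dual d) ⟩
      σ (σ (κ (β (κ x))))      ≡⟨ σ²-dual (κ-primal (β-primal (κ-dual d))) ⟩
      κ (β (κ (κ (β (κ x)))))  ≡⟨ cong (κ ∘ β) (κ-involutive (proj₁ (β-primal (κ-dual d)))) ⟩
      κ (β (β (κ x)))          ≡⟨ cong κ (β-involutive (κ-dual d)) ⟩
      κ (κ x)                  ≡⟨ κ-involutive (proj₁ d) ⟩
      x                        ∎

    σ²-free : ∀ {x} → Paired x → σ (σ x) ≢ x
    σ²-free (inj₁ p) eq = β-free p (trans (sym (σ²-primal p)) eq)
    σ²-free {x} (inj₂ d) eq = β-free (κ-dual d) (begin
      β (κ x)          ≡⟨ κ-involutive (proj₁ (β-primal (κ-dual d))) ⟨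
      κ (κ (β (κ x)))  ≡⟨ cong κ (trans (sym (σ²-dual d)) eq) ⟩
      κ x              ∎)

-- Parity classes and conjugation

Class : Set
Class = Par × Par × Par × Par

parities : Quad → Class
parities (l₁ , m₁ , l₂ , m₂) = parity l₁ , parity m₁ , parity l₂ , parity m₂

sideᶜ : Class → Side
sideᶜ (O , O , O , O) = primal
sideᶜ (E , E , O , E) = primal
sideᶜ (O , E , E , E) = primal
sideᶜ (E , O , O , E) = dual
sideᶜ (E , O , E , O) = dual
sideᶜ (E , E , E , O) = dual
sideᶜ _               = neither

side : Quad → Side
side = sideᶜ ∘ parities

sideᶜ-cong : ∀ {a b c d a′ b′ c′ d′} → a ≡ a′ → b ≡ b′ → c ≡ c′ → d ≡ d′ →
             sideᶜ (a , b , c , d) ≡ sideᶜ (a′ , b′ , c′ , d′)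
sideᶜ-cong refl refl refl refl = refl

opposite : Side → Side
opposite primal  = dual
opposite dual    = primal
opposite neither = neither

sideᶜ-conjugate : ∀ a b c d → sideᶜ (b ⊕ d , c , b , a ⊕ c) ≡ opposite (sideᶜ (a , b , c , d))
sideᶜ-conjugate O O O O = refl
sideᶜ-conjugate O O O E = refl
sideᶜ-conjugate O O E O = refl
sideᶜ-conjugate O O E E = refl
sideᶜ-conjugate O E O O = refl
sideᶜ-conjugate O E O E = refl
sideᶜ-conjugate O E E O = refl
sideᶜ-conjugate O E E E = refl
sideᶜ-conjugate E O O O = refl
sideᶜ-conjugate E O O E = refl
sideᶜ-conjugate E O E O = refl
sideᶜ-conjugate E O E E = refl
sideᶜ-conjugate E E O O = refl
sideᶜ-conjugate E E O E = refl
sideᶜ-conjugate E E E O = refl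
sideᶜ-conjugate E E E E = refl

TwoSize : ℕ → Quad → Set
TwoSize N (l₁ , m₁ , l₂ , m₂) = 0 < m₁ × 0 < l₂ × 0 < m₂ × l₂ < l₁ × l₁ * m₁ + l₂ * m₂ ≡ N

-- Transposing the Ferrers diagram of (l₁^m₁ l₂^m₂) gives ((m₁ + m₂)^l₂ m₁^(l₁ − l₂)).
conjugate : Quad → Quad
conjugate (l₁ , m₁ , l₂ , m₂) = m₁ + m₂ , l₂ , m₁ , l₁ ∸ l₂

conjugate-twoSize : ∀ {N q} → TwoSize N q → TwoSize N (conjugate q)
conjugate-twoSize {N} {l₁ , m₁ , l₂ , m₂} (m₁>0 , l₂>0 , m₂>0 , l₂<l₁ , area) =
  l₂>0 , m₁>0 , m<n⇒0<n∸m l₂<l₁ , m<m+n m₁ m₂>0 , (begin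
    (m₁ + m₂) * l₂ + m₁ * (l₁ ∸ l₂)  ≡⟨ transpose-area m₁ m₂ l₂ (l₁ ∸ l₂) ⟩
    (l₂ + (l₁ ∸ l₂)) * m₁ + l₂ * m₂  ≡⟨ cong (λ l → l * m₁ + l₂ * m₂) (m+[n∸m]≡n (<⇒≤ l₂<l₁)) ⟩
    l₁ * m₁ + l₂ * m₂                ≡⟨ area ⟩
    N                                ∎)
  where
  open ≡-Reasoning
  transpose-area : ∀ a b c d → (a + b) * c + a * d ≡ (c + d) * a + c * b
  transpose-area = solve-∀

conjugate-involutive : ∀ {N q} → TwoSize N q → conjugate (conjugate q) ≡ q
conjugate-involutive {q = l₁ , m₁ , l₂ , m₂} (_ , _ , _ , l₂<l₁ , _)
  rewrite m+[n∸m]≡n (<⇒≤ l₂<l₁) | m+n∸m≡n m₁ m₂ = refl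

side-conjugate : ∀ {N q} → TwoSize N q → side (conjugate q) ≡ opposite (side q)
side-conjugate {q = l₁ , m₁ , l₂ , m₂} (_ , _ , _ , l₂<l₁ , _)
  rewrite parity-+ m₁ m₂ | parity-∸ (<⇒≤ l₂<l₁) =
  sideᶜ-conjugate (parity l₁) (parity m₁) (parity l₂) (parity m₂)

quad-≡ : ∀ {a b c d a′ b′ c′ d′ : ℕ} → (a , b , c , d) ≡ (a′ , b′ , c′ , d′) →
         a ≡ a′ × b ≡ b′ × c ≡ c′ × d ≡ d′
quad-≡ refl = refl , refl , refl , refl

-- The involution β

Block : Set
Block = ℕ × ℕ

infixr 5 _⊞_

_⊞_ : Block → Block → Quad
(l , m) ⊞ (l′ , m′) = l , m , l′ , m′

merge : Block → Block → Quad
merge b@(l , _) b′@(l′ , _) = if does (l′ <? l) then b ⊞ b′ else b′ ⊞ b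

merge-< : ∀ {l m l′ m′} → l′ < l → merge (l , m) (l′ , m′) ≡ (l , m) ⊞ (l′ , m′)
merge-< {l} {l′ = l′} l′<l rewrite dec-true (l′ <? l) l′<l = refl

merge-≤ : ∀ {l m l′ m′} → l ≤ l′ → merge (l , m) (l′ , m′) ≡ (l′ , m′) ⊞ (l , m)
merge-≤ {l} {l′ = l′} l≤l′ rewrite dec-false (l′ <? l) (≤⇒≯ l≤l′) = refl

merge-cases : ∀ x y → merge x y ≡ x ⊞ y ⊎ merge x y ≡ y ⊞ x
merge-cases (l , _) (l′ , _) with does (l′ <? l)
... | true  = inj₁ refl
... | false = inj₂ refl

merge-comm : ∀ {l m l′ m′} → l ≢ l′ → merge (l , m) (l′ , m′) ≡ merge (l′ , m′) (l , m)
merge-comm {l} {l′ = l′} l≢l′ with <-cmp l l′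
... | tri< l<l′ _ _ = trans (merge-≤ (<⇒≤ l<l′)) (sym (merge-< l<l′))
... | tri≈ _ l≡l′ _ = contradiction l≡l′ l≢l′
... | tri> _ _ l>l′ = trans (merge-< l>l′) (sym (merge-≤ (<⇒≤ l>l′)))

⊞-injective : ∀ {x y x′ y′} → x ⊞ y ≡ x′ ⊞ y′ → x ≡ x′ × y ≡ y′
⊞-injective {_ , _} {_ , _} {_ , _} {_ , _} refl = refl , refl

merge-injective : ∀ {x y x′ y′ : Block} → proj₁ x ≢ proj₁ y′ → proj₁ y ≢ proj₁ x′ →
                  merge x y ≡ merge x′ y′ → x ≡ x′ × y ≡ y′
merge-injective {x} {y} {x′} {y′} x≉y′ y≉x′ eq with merge-cases x y | merge-cases x′ y′
... | inj₁ e | inj₁ e′ = ⊞-injective (trans (sym e) (trans eq e′))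
... | inj₁ e | inj₂ e′ = contradiction (cong proj₁ (proj₁ (⊞-injective (trans (sym e) (trans eq e′))))) x≉y′
... | inj₂ e | inj₁ e′ = contradiction (cong proj₁ (proj₁ (⊞-injective (trans (sym e) (trans eq e′))))) y≉x′
... | inj₂ e | inj₂ e′ = let (y≡y′ , x≡x′) = ⊞-injective (trans (sym e) (trans eq e′)) in x≡x′ , y≡y′

merge-twoSize : ∀ {N l m l′ m′} → l′ ≢ l → 0 < l → 0 < m → 0 < l′ → 0 < m′ →
                l * m + l′ * m′ ≡ N → TwoSize N (merge (l , m) (l′ , m′))
merge-twoSize {l = l} {m} {l′} {m′} l′≢l l>0 m>0 l′>0 m′>0 area with <-cmp l′ l
... | tri< l′<l _ _ rewrite merge-< {m = m} {m′ = m′} l′<l = m>0 , l′>0 , m′>0 , l′<l , area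
... | tri≈ _ l′≡l _ = contradiction l′≡l l′≢l
... | tri> _ _ l<l′ rewrite merge-≤ {m = m} {m′ = m′} (<⇒≤ l<l′) =
  m′>0 , l>0 , m>0 , l<l′ , trans (+-comm (l′ * m′) (l * m)) area

merge-twoSize⁻ : ∀ {N l m l′ m′} → TwoSize N (merge (l , m) (l′ , m′)) →
                 0 < l × 0 < m × 0 < l′ × 0 < m′ × l * m + l′ * m′ ≡ N
merge-twoSize⁻ {N} {l} {m} {l′} {m′} v with l′ <? l
... | yes l′<l rewrite merge-< {m = m} {m′ = m′} l′<l =
  let (m>0 , l′>0 , m′>0 , _ , area) = v in <-≤-trans z<s l′<l , m>0 , l′>0 , m′>0 , area
... | no l′≮l rewrite merge-≤ {m = m} {m′ = m′} (≮⇒≥ l′≮l) =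
  let (m′>0 , l>0 , m>0 , l<l′ , area) = v in
  l>0 , m>0 , <-≤-trans z<s l<l′ , m′>0 , trans (+-comm (l * m) (l′ * m′)) area

φ : Block → Block
φ (l , m) with parity l | parity m
... | O | E = ⌊ m /2⌋ , 2 * l
... | _ | _ = m , l

equimultiple : ℕ → ℕ → ℕ → Quad
equimultiple l k m = l + 2 * suc k , m , l , m

square : ℕ → ℕ → Quad
square p r = merge (p , r) (r , p)

equimultiplePartner : ℕ → ℕ → ℕ → Quad
equimultiplePartner l k m with l ≟ k
... | yes _ = square m (suc (2 * l))
... | no _  = equimultiple k l m

-- Of two odd p, r with 2pr ≡ 14 (mod 16) exactly one is ≡ 3 (mod 4); it is the
-- 1 + 2l of the diagonal partner, so that l is odd.
squarePartner : ℕ → ℕ → Quad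
squarePartner p r with parity ⌊ p /2⌋
... | O = equimultiple ⌊ p /2⌋ ⌊ p /2⌋ r
... | E = equimultiple ⌊ r /2⌋ ⌊ r /2⌋ p

β : Quad → Quad
β (l₁ , m₁ , l₂ , m₂) with parity l₁ | parity m₁ | parity l₂ | parity m₂ | m₁ ≟ m₂ | l₁ ≟ m₂ ×-dec l₂ ≟ m₁
... | O | O | O | O | yes _ | _     = equimultiplePartner l₂ (⌊ l₁ ∸ l₂ /2⌋ ∸ 1) m₁
... | O | O | O | O | no _  | yes _ = squarePartner l₁ l₂
... | _ | _ | _ | _ | _     | _     = merge (φ (l₁ , m₁)) (φ (l₂ , m₂))

mixed : ℕ → ℕ → ℕ → ℕ → Quad
mixed a b c d = merge (2 * a , 2 * b) (suc (2 * c) , 2 * suc (2 * d))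

φ-even : ∀ a b → φ (2 * a , 2 * b) ≡ (2 * b , 2 * a)
φ-even a b rewrite parity-2* a = refl

φ-odd-even : ∀ c d → φ (suc (2 * c) , 2 * suc (2 * d)) ≡ (suc (2 * d) , 2 * suc (2 * c))
φ-odd-even c d rewrite parity-1+2* c | parity-2* (suc (2 * d)) | ⌊2*n/2⌋≡n (suc (2 * d)) = refl

φ-odd-odd : ∀ {l m} → parity l ≡ O → parity m ≡ O → φ (l , m) ≡ (m , l)
φ-odd-odd ol om rewrite ol | om = refl

β-mixed : ∀ a b c d → β (mixed a b c d) ≡ mixed b a d c
β-mixed a b c d with <-cmp (suc (2 * c)) (2 * a)
... | tri< o<e _ _ rewrite merge-< {m = 2 * b} {m′ = 2 * suc (2 * d)} o<e | parity-2* a =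
  cong₂ merge (φ-even a b) (φ-odd-even c d)
... | tri≈ _ o≡e _ = contradiction (sym o≡e) (2*≢1+2* a c)
... | tri> _ _ e<o rewrite merge-≤ {m = 2 * b} {m′ = 2 * suc (2 * d)} (<⇒≤ e<o)
                         | parity-1+2* c | parity-2* (suc (2 * d)) =
  trans (cong₂ merge (φ-odd-even c d) (φ-even a b)) (merge-comm (2*≢1+2* b d ∘ sym))

β-generic : ∀ {l₁ m₁ l₂ m₂} → parity l₁ ≡ O → parity m₁ ≡ O → parity l₂ ≡ O → parity m₂ ≡ O →
            m₁ ≢ m₂ → ¬ (l₁ ≡ m₂ × l₂ ≡ m₁) → β (l₁ , m₁ , l₂ , m₂) ≡ merge (m₁ , l₁) (m₂ , l₂)
β-generic {l₁} {m₁} {l₂} {m₂} o₁ o₂ o₃ o₄ m₁≢m₂ not-square rewrite o₁ | o₂ | o₃ | o₄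
  with m₁ ≟ m₂ | l₁ ≟ m₂ ×-dec l₂ ≟ m₁
... | yes m₁≡m₂ | _      = contradiction m₁≡m₂ m₁≢m₂
... | no _      | yes sq = contradiction sq not-square
... | no _      | no _   = cong₂ merge (φ-odd-odd o₁ o₂) (φ-odd-odd o₃ o₄)

β-square : ∀ {p r} → parity p ≡ O → parity r ≡ O → r < p → β (p , r , r , p) ≡ squarePartner p r
β-square {p} {r} op or r<p rewrite op | or with r ≟ p | p ≟ p ×-dec r ≟ r
... | yes r≡p | _      = contradiction r≡p (<⇒≢ r<p)
... | no _    | yes _  = refl
... | no _    | no ¬sq = contradiction (refl , refl) ¬sq

β-equimultiple : ∀ l k m → parity l ≡ O → parity m ≡ O → β (equimultiple l k m) ≡ equimultiplePartner l k m
β-equimultiple l k m ol om rewrite parity-+ l (2 * suc k) | ol | parity-2* (suc k) | om with m ≟ m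
... | no m≢m = contradiction refl m≢m
... | yes _  = cong (λ j → equimultiplePartner l j m) (begin
  ⌊ l + 2 * suc k ∸ l /2⌋ ∸ 1  ≡⟨ cong (λ n → ⌊ n /2⌋ ∸ 1) (m+n∸m≡n l (2 * suc k)) ⟩
  ⌊ 2 * suc k /2⌋ ∸ 1          ≡⟨ cong (_∸ 1) (⌊2*n/2⌋≡n (suc k)) ⟩
  k                            ∎)
  where open ≡-Reasoning

equimultiplePartner-≢ : ∀ {l k m} → l ≢ k → equimultiplePartner l k m ≡ equimultiple k l m
equimultiplePartner-≢ {l} {k} l≢k with l ≟ k
... | yes l≡k = contradiction l≡k l≢k
... | no _    = refl

equimultiplePartner-diagonal : ∀ l m → equimultiplePartner l l m ≡ square m (suc (2 * l))
equimultiplePartner-diagonal l m with l ≟ l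
... | yes _  = refl
... | no l≢l = contradiction refl l≢l

squarePartner-odd : ∀ p r → parity ⌊ p /2⌋ ≡ O → squarePartner p r ≡ equimultiple ⌊ p /2⌋ ⌊ p /2⌋ r
squarePartner-odd p r o rewrite o = refl

squarePartner-even : ∀ p r → parity ⌊ p /2⌋ ≡ E → squarePartner p r ≡ equimultiple ⌊ r /2⌋ ⌊ r /2⌋ p
squarePartner-even p r e rewrite e = refl

side-mixed : ∀ a b c d → side (mixed a b c d) ≡ primal
side-mixed a b c d with <-cmp (suc (2 * c)) (2 * a)
... | tri< o<e _ _ = trans (cong side (merge-< o<e))
  (sideᶜ-cong (parity-2* a) (parity-2* b) (parity-1+2* c) (parity-2* (suc (2 * d))))
... | tri≈ _ o≡e _ = contradiction (sym o≡e) (2*≢1+2* a c)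
... | tri> _ _ e<o = trans (cong side (merge-≤ (<⇒≤ e<o)))
  (sideᶜ-cong (parity-1+2* c) (parity-2* (suc (2 * d))) (parity-2* a) (parity-2* b))

side-equimultiple : ∀ l k m → parity l ≡ O → parity m ≡ O → side (equimultiple l k m) ≡ primal
side-equimultiple l k m ol om =
  sideᶜ-cong (trans (parity-+ l (2 * suc k)) (cong₂ _⊕_ ol (parity-2* (suc k)))) om ol om

equimultiple-twoSize : ∀ {N l k m} → 0 < l → 0 < m → (l + 2 * suc k) * m + l * m ≡ N →
                       TwoSize N (equimultiple l k m)
equimultiple-twoSize {l = l} l>0 m>0 area = m>0 , l>0 , m>0 , m<m+n l z<s , area

diagonal-area : ∀ l m → (l + 2 * suc l) * m + l * m ≡ m * suc (2 * l) + suc (2 * l) * m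
diagonal-area = solve-∀

record Matched (N : ℕ) (q : Quad) : Set where
  field
    image-twoSize  : TwoSize N (β q)
    image-primal   : side (β q) ≡ primal
    involutive     : β (β q) ≡ q
    no-fixed-point : β q ≢ q

matched-via : ∀ {N q q′} → β q ≡ q′ → TwoSize N q′ → side q′ ≡ primal → β q′ ≡ q → q′ ≢ q → Matched N q
matched-via refl v p inv q′≢q = record
  { image-twoSize = v ; image-primal = p ; involutive = inv ; no-fixed-point = q′≢q }

Matched-β : ∀ {N q} → TwoSize N q → side q ≡ primal → Matched N q → Matched N (β q)
Matched-β v p m = record
  { image-twoSize  = subst (TwoSize _) (sym involutive) v
  ; image-primal   = subst (λ x → side x ≡ primal) (sym involutive) p
  ; involutive     = cong β involutive
  ; no-fixed-point = λ eq → no-fixed-point (trans (sym eq) involutive)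
  }
  where open Matched m

concatMap-map : ∀ {A B C : Set} (g : A × B → C) xs ys →
                concatMap (λ x → map (λ y → g (x , y)) ys) xs ≡ map g (cartesianProduct xs ys)
concatMap-map g []       ys = refl
concatMap-map g (x ∷ xs) ys = begin
  map (λ y → g (x , y)) ys ++ concatMap (λ x → map (λ y → g (x , y)) ys) xs
    ≡⟨ cong₂ _++_ (map-∘ ys) (concatMap-map g xs ys) ⟩
  map g (map (x ,_) ys) ++ map g (cartesianProduct xs ys)
    ≡⟨ map-++ g (map (x ,_) ys) (cartesianProduct xs ys) ⟨
  map g (cartesianProduct (x ∷ xs) ys)
    ∎
  where open ≡-Reasoning

candidates≡ : ∀ N → let R = range1 N in
              candidates N ≡ cartesianProduct R (cartesianProduct R (cartesianProduct R R))
candidates≡ N = begin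
  candidates N
    ≡⟨ concatMap-cong (λ a → concatMap-cong (λ b → concatMap-map (λ cd → a , b , cd) R R) R) R ⟩
  concatMap (λ a → concatMap (λ b → map (λ cd → a , b , cd) R²) R) R
    ≡⟨ concatMap-cong (λ a → concatMap-map (a ,_) R R²) R ⟩
  concatMap (λ a → map (a ,_) R³) R
    ≡⟨ concatMap-map id R R³ ⟩
  map id (cartesianProduct R R³)
    ≡⟨ map-id _ ⟩
  cartesianProduct R R³
    ∎
  where
  open ≡-Reasoning
  R = range1 N
  R² = cartesianProduct R R
  R³ = cartesianProduct R R²

range1-unique : ∀ N → Unique (range1 N)
range1-unique N = Unique.map⁺ suc-injective (Unique.upTo⁺ N)

∈-range1⁺ : ∀ {N k} → 0 < k → k ≤ N → k ∈ range1 N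
∈-range1⁺ {k = suc j} _ j<N = ∈-map⁺ suc (∈-upTo⁺ j<N)

∈-range1⁻ : ∀ {N k} → k ∈ range1 N → 0 < k
∈-range1⁻ k∈ with _ , _ , refl ← ∈-map⁻ suc k∈ = z<s

candidates-unique : ∀ N → Unique (candidates N)
candidates-unique N = subst Unique (sym (candidates≡ N))
  (Unique.cartesianProduct⁺ R! (Unique.cartesianProduct⁺ R! (Unique.cartesianProduct⁺ R! R!)))
  where R! = range1-unique N

∈-candidates⁺ : ∀ {N l₁ m₁ l₂ m₂} → 0 < l₁ → l₁ ≤ N → 0 < m₁ → m₁ ≤ N → 0 < l₂ → l₂ ≤ N → 0 < m₂ → m₂ ≤ N →
                (l₁ , m₁ , l₂ , m₂) ∈ candidates N
∈-candidates⁺ {N} l₁>0 l₁≤N m₁>0 m₁≤N l₂>0 l₂≤N m₂>0 m₂≤N = subst (_ ∈_) (sym (candidates≡ N))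
  (∈-cartesianProduct⁺ (∈-range1⁺ l₁>0 l₁≤N) (∈-cartesianProduct⁺ (∈-range1⁺ m₁>0 m₁≤N)
    (∈-cartesianProduct⁺ (∈-range1⁺ l₂>0 l₂≤N) (∈-range1⁺ m₂>0 m₂≤N))))

∈-candidates⁻ : ∀ {N l₁ m₁ l₂ m₂} → (l₁ , m₁ , l₂ , m₂) ∈ candidates N → 0 < m₁ × 0 < l₂ × 0 < m₂
∈-candidates⁻ {N} q∈ =
  let (_ , bcd∈) = ∈-cartesianProduct⁻ R R³ (subst (_ ∈_) (candidates≡ N) q∈)
      (m₁∈ , cd∈) = ∈-cartesianProduct⁻ R R² bcd∈
      (l₂∈ , m₂∈) = ∈-cartesianProduct⁻ R R cd∈
  in ∈-range1⁻ m₁∈ , ∈-range1⁻ l₂∈ , ∈-range1⁻ m₂∈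
  where
  R = range1 N
  R² = cartesianProduct R R
  R³ = cartesianProduct R R²

isTwoSize-sound : ∀ {N l₁ m₁ l₂ m₂} → isTwoSize N (l₁ , m₁ , l₂ , m₂) ≡ true →
                  l₂ < l₁ × l₁ * m₁ + l₂ * m₂ ≡ N
isTwoSize-sound {N} {l₁} {m₁} {l₂} {m₂} _ with l₂ <? l₁ | l₁ * m₁ + l₂ * m₂ ≟ N
isTwoSize-sound () | no _   | _
isTwoSize-sound () | yes _  | no _
isTwoSize-sound _  | yes lt | yes eq = lt , eq

isTwoSize-complete : ∀ {N l₁ m₁ l₂ m₂} → l₂ < l₁ → l₁ * m₁ + l₂ * m₂ ≡ N →
                     isTwoSize N (l₁ , m₁ , l₂ , m₂) ≡ true
isTwoSize-complete {N} {l₁} {m₁} {l₂} {m₂} lt eq with l₂ <? l₁ | l₁ * m₁ + l₂ * m₂ ≟ N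
... | yes _  | yes _  = refl
... | no ¬lt | _      = contradiction lt ¬lt
... | yes _  | no ¬eq = contradiction eq ¬eq

∈-twoSizePartitions⁺ : ∀ {N q} → TwoSize N q → q ∈ twoSizePartitions N
∈-twoSizePartitions⁺ {N} {l₁ , m₁ , l₂ , m₂} (m₁>0 , l₂>0 , m₂>0 , l₂<l₁ , area) =
  ∈-filter⁺ (λ q → isTwoSize N q Bool.≟ true)
    (∈-candidates⁺ l₁>0 (part≤N m₁>0 area) m₁>0 (part≤N l₁>0 area₁) l₂>0 (part≤N m₂>0 area₂) m₂>0 (part≤N l₂>0 area₃))
    (isTwoSize-complete l₂<l₁ area)
  where
  l₁>0 = <-≤-trans z<s l₂<l₁
  part≤N : ∀ {x y z} → 0 < y → x * y + z ≡ N → x ≤ N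
  part≤N {x} {y} {z} y>0 eq = subst (x ≤_) eq (≤-trans (m≤m*n x y {{>-nonZero y>0}}) (m≤m+n (x * y) z))
  area₁ = trans (cong (_+ l₂ * m₂) (*-comm m₁ l₁)) area
  area₂ = trans (+-comm (l₂ * m₂) (l₁ * m₁)) area
  area₃ = trans (cong (_+ l₁ * m₁) (*-comm m₂ l₂)) area₂

∈-twoSizePartitions⁻ : ∀ {N q} → q ∈ twoSizePartitions N → TwoSize N q
∈-twoSizePartitions⁻ {N} q∈ =
  let (q∈cand , ok) = ∈-filter⁻ (λ q → isTwoSize N q Bool.≟ true) q∈
      (m₁>0 , l₂>0 , m₂>0) = ∈-candidates⁻ {N} q∈cand
      (l₂<l₁ , area) = isTwoSize-sound ok
  in m₁>0 , l₂>0 , m₂>0 , l₂<l₁ , area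

_≟Q_ : DecidableEquality Quad
_≟Q_ = ≡-dec _≟_ (≡-dec _≟_ (≡-dec _≟_ _≟_))

paired : Side → Bool
paired primal  = true
paired dual    = true
paired neither = false

paired-true : ∀ s → paired s ≡ true → s ≡ primal ⊎ s ≡ dual
paired-true primal _ = inj₁ refl
paired-true dual   _ = inj₂ refl

isPaired : Quad → Bool
isPaired = paired ∘ side

inClassᶜ : Par → Par → Par → Par → Class → Bool
inClassᶜ A B C D (a , b , c , d) = (a ≟P A) ∧ (b ≟P B) ∧ (c ≟P C) ∧ (d ≟P D)

sixClasses : List (Class → Bool)
sixClasses = inClassᶜ E O O E ∷ inClassᶜ E E O E ∷ inClassᶜ O E E E
           ∷ inClassᶜ O O O O ∷ inClassᶜ E O E O ∷ inClassᶜ E E E O ∷ []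

sixClasses-partition : ∀ c → sum (map (λ k → ind (k c)) sixClasses) ≡ ind (paired (sideᶜ c))
sixClasses-partition (O , O , O , O) = refl
sixClasses-partition (O , O , O , E) = refl
sixClasses-partition (O , O , E , O) = refl
sixClasses-partition (O , O , E , E) = refl
sixClasses-partition (O , E , O , O) = refl
sixClasses-partition (O , E , O , E) = refl
sixClasses-partition (O , E , E , O) = refl
sixClasses-partition (O , E , E , E) = refl
sixClasses-partition (E , O , O , O) = refl
sixClasses-partition (E , O , O , E) = refl
sixClasses-partition (E , O , E , O) = refl
sixClasses-partition (E , O , E , E) = refl
sixClasses-partition (E , E , O , O) = refl
sixClasses-partition (E , E , O , E) = refl
sixClasses-partition (E , E , E , O) = refl
sixClasses-partition (E , E , E , E) = refl

six-counts≡ : ∀ N → count E O O E N + count E E O E N + count O E E E N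
                    + count O O O O N + count E O E O N + count E E E O N
                  ≡ #[ isPaired ] (twoSizePartitions N)
six-counts≡ N =
  trans (reassociate (count E O O E N) (count E E O E N) (count O E E E N)
                     (count O O O O N) (count E O E O N) (count E E E O N))
        (#-sum (map (_∘ parities) sixClasses) isPaired (sixClasses-partition ∘ parities) (twoSizePartitions N))
  where
  reassociate : ∀ a b c d e f → a + b + c + d + e + f ≡ a + (b + (c + (d + (e + (f + 0)))))
  reassociate = solve-∀

module _ {N : ℕ} (N%16≡14 : N % 16 ≡ 14) where

  -- Arithmetic consequences of N ≡ 14 (mod 16)

  N%8≡6 : N % 8 ≡ 6
  N%8≡6 = trans (sym (m∣n⇒o%n%m≡o%m 8 16 N (divides 2 refl))) (cong (_% 8) N%16≡14)

  N%4≡2 : N % 4 ≡ 2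
  N%4≡2 = trans (sym (m∣n⇒o%n%m≡o%m 4 16 N (divides 4 refl))) (cong (_% 4) N%16≡14)

  residue : ∀ {n} .{{_ : NonZero n}} r k → N ≡ r + k * n → N % n ≡ r % n
  residue {n} r k eq = trans (cong (_% n) eq) ([m+kn]%n≡m%n r k n)

  4∤N : ¬ 4 ∣ N
  4∤N 4∣N with () ← trans (sym N%4≡2) (n∣m⇒m%n≡0 N 4 4∣N)

  N≢2[8] : ∀ k → N ≢ 2 + k * 8
  N≢2[8] k eq with () ← trans (sym N%8≡6) (residue 2 k eq)

  N≢2[16] : ∀ k → N ≢ 2 + k * 16
  N≢2[16] k eq with () ← trans (sym N%16≡14) (residue 2 k eq)

  N≢6[16] : ∀ k → N ≢ 6 + k * 16
  N≢6[16] k eq with () ← trans (sym N%16≡14) (residue 6 k eq)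

  odd²+odd² : ∀ x y → parity x ≡ O → parity y ≡ O → N ≢ x * x + y * y
  odd²+odd² x y ox oy eq with u , refl ← odd⇒ x ox | v , refl ← odd⇒ y oy
    with t , u² ← odd-square u | s , v² ← odd-square v =
    N≢2[8] (t + s) (begin
      N                                                      ≡⟨ eq ⟩
      suc (2 * u) * suc (2 * u) + suc (2 * v) * suc (2 * v)  ≡⟨ cong₂ _+_ u² v² ⟩
      1 + t * 8 + (1 + s * 8)                                ≡⟨ lemma t s ⟩
      2 + (t + s) * 8                                        ∎)
    where
    open ≡-Reasoning
    lemma : ∀ t s → 1 + t * 8 + (1 + s * 8) ≡ 2 + (t + s) * 8
    lemma = solve-∀

  even²+2odd² : ∀ a c → N ≢ 2 * a * (2 * a) + suc (2 * c) * (2 * suc (2 * c))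
  even²+2odd² a c eq with t , c² ← odd-square c =
    by-parity (parityView a) (trans eq (trans (split a c) (cong (λ s → 4 * (a * a) + 2 * s) c²)))
    where
    split : ∀ a c → 2 * a * (2 * a) + suc (2 * c) * (2 * suc (2 * c)) ≡ 4 * (a * a) + 2 * (suc (2 * c) * suc (2 * c))
    split = solve-∀
    by-parity : ∀ {a} → ParityView a → N ≢ 4 * (a * a) + 2 * (1 + t * 8)
    by-parity (even g) eq′ = N≢2[16] (g * g + t) (trans eq′ (lemma g t))
      where
      lemma : ∀ g t → 4 * (2 * g * (2 * g)) + 2 * (1 + t * 8) ≡ 2 + (g * g + t) * 16
      lemma = solve-∀
    by-parity (odd g) eq′ = N≢6[16] (g * g + g + t) (trans eq′ (lemma g t))
      where
      lemma : ∀ g t → 4 * (suc (2 * g) * suc (2 * g)) + 2 * (1 + t * 8) ≡ 6 + (g * g + g + t) * 16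
      lemma = solve-∀

  odd-halves-differ : ∀ p r → parity p ≡ O → parity r ≡ O → N ≡ p * r + r * p →
                      parity ⌊ p /2⌋ ≢ parity ⌊ r /2⌋
  odd-halves-differ p r op or eq halves≡ with u , refl ← odd⇒ p op | v , refl ← odd⇒ r or =
    same-parity (parityView u) (parityView v)
      (subst₂ (λ x y → parity x ≡ parity y) (⌊1+2*n/2⌋≡n u) (⌊1+2*n/2⌋≡n v) halves≡) eq
    where
    same-parity : ∀ {u v} → ParityView u → ParityView v → parity u ≡ parity v →
                  N ≢ suc (2 * u) * suc (2 * v) + suc (2 * v) * suc (2 * u)
    same-parity (even x) (even y) _ eq = N≢2[8] (x + y + 4 * x * y) (trans eq (lemma x y))
      where
      lemma : ∀ x y → suc (2 * (2 * x)) * suc (2 * (2 * y)) + suc (2 * (2 * y)) * suc (2 * (2 * x))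
                      ≡ 2 + (x + y + 4 * x * y) * 8
      lemma = solve-∀
    same-parity (odd x) (odd y) _ eq = N≢2[8] (2 + 3 * x + 3 * y + 4 * x * y) (trans eq (lemma x y))
      where
      lemma : ∀ x y → suc (2 * suc (2 * x)) * suc (2 * suc (2 * y)) + suc (2 * suc (2 * y)) * suc (2 * suc (2 * x))
                      ≡ 2 + (2 + 3 * x + 3 * y + 4 * x * y) * 8
      lemma = solve-∀
    same-parity (even x) (odd y) pu≡pv with () ← trans (sym (parity-2* x)) (trans pu≡pv (parity-1+2* y))
    same-parity (odd x) (even y) pu≡pv with () ← trans (sym (parity-1+2* x)) (trans pu≡pv (parity-2* y))

  half-multiplicity-odd : ∀ a b x h → 2 * a * (2 * b) + x * (2 * h) ≡ N → parity h ≡ O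
  half-multiplicity-odd a b x h area with parity h in ph
  ... | O = refl
  ... | E with g , refl ← even⇒ h ph =
    contradiction (divides (a * b + x * g) (trans (sym area) (lemma a b x g))) 4∤N
    where
    lemma : ∀ a b x g → 2 * a * (2 * b) + x * (2 * (2 * g)) ≡ (a * b + x * g) * 4
    lemma = solve-∀

  equimultiple-odd-k : ∀ l k m → parity l ≡ O → parity m ≡ O → TwoSize N (equimultiple l k m) → parity k ≡ O
  equimultiple-odd-k l k m ol om (_ , _ , _ , _ , area) with parity k in pk
  ... | O = refl
  ... | E with w , refl ← even⇒ k pk | u , refl ← odd⇒ l ol =
    contradiction (divides ((u + w + 1) * m) (trans (sym area) (lemma u w m))) 4∤N
    where
    lemma : ∀ u w m → (suc (2 * u) + 2 * suc (2 * w)) * m + suc (2 * u) * m ≡ (u + w + 1) * m * 4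
    lemma = solve-∀

  mixed-matched : ∀ a b c d → TwoSize N (mixed a b c d) → Matched N (mixed a b c d)
  mixed-matched a b c d v = matched-via (β-mixed a b c d) twoSize′ (side-mixed b a d c) (β-mixed b a d c) moved
    where
    parts = merge-twoSize⁻ {N} {2 * a} {2 * b} {suc (2 * c)} {2 * suc (2 * d)} v
    twoSize′ : TwoSize N (mixed b a d c)
    twoSize′ = let (2a>0 , 2b>0 , _ , _ , area) = parts in
      merge-twoSize (2*≢1+2* b d ∘ sym) 2b>0 2a>0 z<s z<s (trans (swap-area a b c d) area)
      where
      swap-area : ∀ a b c d → 2 * b * (2 * a) + suc (2 * d) * (2 * suc (2 * c))
                              ≡ 2 * a * (2 * b) + suc (2 * c) * (2 * suc (2 * d))
      swap-area = solve-∀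
    moved : mixed b a d c ≢ mixed a b c d
    moved eq with evens , odds ← merge-injective (2*≢1+2* b c) (2*≢1+2* a d ∘ sym) eq
      with refl ← *-cancelˡ-≡ b a 2 (cong proj₁ evens)
         | refl ← *-cancelˡ-≡ d c 2 (suc-injective (cong proj₁ odds)) =
      even²+2odd² a c (sym (proj₂ (proj₂ (proj₂ (proj₂ parts)))))

  generic-matched : ∀ {l₁ m₁ l₂ m₂} → TwoSize N (l₁ , m₁ , l₂ , m₂) →
                    parity l₁ ≡ O → parity m₁ ≡ O → parity l₂ ≡ O → parity m₂ ≡ O →
                    m₁ ≢ m₂ → ¬ (l₁ ≡ m₂ × l₂ ≡ m₁) → Matched N (l₁ , m₁ , l₂ , m₂)
  generic-matched {l₁} {m₁} {l₂} {m₂} (m₁>0 , l₂>0 , m₂>0 , l₂<l₁ , area) o₁ o₂ o₃ o₄ m₁≢m₂ not-square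
    with <-cmp m₂ m₁
  ... | tri< m₂<m₁ _ _ = matched-via (trans (β-generic o₁ o₂ o₃ o₄ m₁≢m₂ not-square) (merge-< m₂<m₁))
    (<-≤-trans z<s l₂<l₁ , m₂>0 , l₂>0 , m₂<m₁ , trans (cong₂ _+_ (*-comm m₁ l₁) (*-comm m₂ l₂)) area)
    (sideᶜ-cong o₂ o₁ o₄ o₃)
    (trans (β-generic o₂ o₁ o₄ o₃ (<⇒≢ l₂<l₁ ∘ sym) not-square′) (merge-< l₂<l₁))
    (λ eq → let (m₁≡l₁ , _ , m₂≡l₂ , _) = quad-≡ eq in
      odd²+odd² l₁ l₂ o₁ o₃ (sym (subst₂ (λ x y → l₁ * x + l₂ * y ≡ N) m₁≡l₁ m₂≡l₂ area)))
    where
    not-square′ : ¬ (m₁ ≡ l₂ × m₂ ≡ l₁)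
    not-square′ (m₁≡l₂ , m₂≡l₁) = <-asym l₂<l₁ (subst₂ _<_ m₂≡l₁ m₁≡l₂ m₂<m₁)
  ... | tri≈ _ m₂≡m₁ _ = contradiction (sym m₂≡m₁) m₁≢m₂
  ... | tri> _ _ m₁<m₂ = matched-via (trans (β-generic o₁ o₂ o₃ o₄ m₁≢m₂ not-square) (merge-≤ (<⇒≤ m₁<m₂)))
    (l₂>0 , m₁>0 , <-≤-trans z<s l₂<l₁ , m₁<m₂ ,
      trans (+-comm (m₂ * l₂) (m₁ * l₁)) (trans (cong₂ _+_ (*-comm m₁ l₁) (*-comm m₂ l₂)) area))
    (sideᶜ-cong o₄ o₃ o₂ o₁)
    (trans (β-generic o₄ o₃ o₂ o₁ (<⇒≢ l₂<l₁) (λ (m₂≡l₁ , m₁≡l₂) → not-square (sym m₂≡l₁ , sym m₁≡l₂)))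
           (merge-≤ (<⇒≤ l₂<l₁)))
    (λ eq → let (m₂≡l₁ , l₂≡m₁ , _ , _) = quad-≡ eq in not-square (sym m₂≡l₁ , l₂≡m₁))

  equimultiple-matched : ∀ l k m → parity l ≡ O → parity m ≡ O → l ≢ k → TwoSize N (equimultiple l k m) →
                         Matched N (equimultiple l k m)
  equimultiple-matched l k m ol om l≢k v@(m>0 , _ , _ , _ , area) = matched-via
    (trans (β-equimultiple l k m ol om) (equimultiplePartner-≢ l≢k))
    (equimultiple-twoSize (odd⇒pos ok) m>0 (trans (swap-area l k m) area))
    (side-equimultiple k l m ok om)
    (trans (β-equimultiple k l m ok om) (equimultiplePartner-≢ (l≢k ∘ sym)))
    (λ eq → l≢k (sym (proj₁ (proj₂ (proj₂ (quad-≡ eq))))))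
    where
    ok = equimultiple-odd-k l k m ol om v
    swap-area : ∀ l k m → (k + 2 * suc l) * m + k * m ≡ (l + 2 * suc k) * m + l * m
    swap-area = solve-∀

  diagonal-matched : ∀ l m → parity l ≡ O → parity m ≡ O → TwoSize N (equimultiple l l m) →
                     Matched N (equimultiple l l m)
  diagonal-matched l m ol om (m>0 , _ , _ , _ , area) = by-order (<-cmp K m)
    where
    K = suc (2 * l)
    oK = parity-1+2* l
    ⌊K/2⌋≡l = ⌊1+2*n/2⌋≡n l
    image : β (equimultiple l l m) ≡ square m K
    image = trans (β-equimultiple l l m ol om) (equimultiplePartner-diagonal l m)
    areaᴷ : m * K + K * m ≡ N
    areaᴷ = trans (sym (diagonal-area l m)) area
    ⌊K/2⌋-odd : parity ⌊ K /2⌋ ≡ O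
    ⌊K/2⌋-odd = trans (cong parity ⌊K/2⌋≡l) ol
    ⌊m/2⌋-even : parity ⌊ m /2⌋ ≡ E
    ⌊m/2⌋-even with parity ⌊ m /2⌋ in pm
    ... | E = refl
    ... | O = contradiction (trans ⌊K/2⌋-odd (sym pm))
                (odd-halves-differ K m oK om (trans (sym areaᴷ) (+-comm (m * K) (K * m))))
    by-order : Tri (K < m) (K ≡ m) (m < K) → Matched N (equimultiple l l m)
    by-order (tri< K<m _ _) = matched-via (trans image (merge-< K<m))
      (z<s , z<s , m>0 , K<m , areaᴷ)
      (sideᶜ-cong om oK oK om)
      (trans (β-square om oK K<m)
        (trans (squarePartner-even m K ⌊m/2⌋-even) (cong (λ j → equimultiple j j m) ⌊K/2⌋≡l)))
      (λ eq → <⇒≢ K<m (proj₁ (proj₂ (quad-≡ eq))))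
    by-order (tri≈ _ K≡m _) =
      ⊥-elim (odd-halves-differ K K oK oK (trans (sym areaᴷ) (cong (λ x → x * K + K * x) (sym K≡m))) refl)
    by-order (tri> _ _ m<K) = matched-via (trans image (merge-≤ (<⇒≤ m<K)))
      (m>0 , m>0 , z<s , m<K , trans (+-comm (K * m) (m * K)) areaᴷ)
      (sideᶜ-cong oK om om oK)
      (trans (β-square oK om m<K)
        (trans (squarePartner-odd K m ⌊K/2⌋-odd) (cong (λ j → equimultiple j j m) ⌊K/2⌋≡l)))
      (λ eq → <⇒≢ m<K (sym (proj₂ (proj₂ (proj₂ (quad-≡ eq))))))

  square-via-diagonal : ∀ {q} l m → parity l ≡ O → parity m ≡ O → square m (suc (2 * l)) ≡ q →
                        (l + 2 * suc l) * m + l * m ≡ N → Matched N q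
  square-via-diagonal l m ol om sq area =
    subst (Matched N) (trans (β-equimultiple l l m ol om) (trans (equimultiplePartner-diagonal l m) sq))
      (Matched-β v (side-equimultiple l l m ol om) (diagonal-matched l m ol om v))
    where
    v = equimultiple-twoSize (odd⇒pos ol) (odd⇒pos om) area

  square-matched : ∀ p r → parity p ≡ O → parity r ≡ O → r < p → TwoSize N (p , r , r , p) →
                   Matched N (p , r , r , p)
  square-matched p r op or r<p (_ , _ , _ , _ , area) with parity ⌊ p /2⌋ in pp
  ... | O = square-via-diagonal ⌊ p /2⌋ r pp or
    (trans (cong (square r) (odd⇒1+2*⌊n/2⌋ op)) (merge-≤ (<⇒≤ r<p)))
    (trans (diagonal-area ⌊ p /2⌋ r)
      (trans (cong (λ K → r * K + K * r) (odd⇒1+2*⌊n/2⌋ op)) (trans (+-comm (r * p) (p * r)) area)))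
  ... | E with parity ⌊ r /2⌋ in pr
  ...   | O = square-via-diagonal ⌊ r /2⌋ p pr op
    (trans (cong (square p) (odd⇒1+2*⌊n/2⌋ or)) (merge-< r<p))
    (trans (diagonal-area ⌊ r /2⌋ p) (trans (cong (λ K → p * K + K * p) (odd⇒1+2*⌊n/2⌋ or)) area))
  ...   | E = ⊥-elim (odd-halves-differ p r op or (sym area) (trans pp (sym pr)))

  odd-gap : ∀ {l₁ l₂} → l₂ < l₁ → parity l₁ ≡ O → parity l₂ ≡ O → ∃[ k ] l₁ ≡ l₂ + 2 * suc k
  odd-gap {l₁} {l₂} l₂<l₁ o₁ o₂ with even⇒ (l₁ ∸ l₂) (trans (parity-∸ (<⇒≤ l₂<l₁)) (cong₂ _⊕_ o₁ o₂))
  ... | zero  , gap≡0  = contradiction gap≡0 (≢-sym (<⇒≢ (m<n⇒0<n∸m l₂<l₁)))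
  ... | suc k , gap≡2j = k , trans (sym (m+[n∸m]≡n (<⇒≤ l₂<l₁))) (cong (l₂ +_) gap≡2j)

  equal-multiplicities-matched : ∀ {l₁ m l₂} → TwoSize N (l₁ , m , l₂ , m) →
                                 parity l₁ ≡ O → parity m ≡ O → parity l₂ ≡ O → Matched N (l₁ , m , l₂ , m)
  equal-multiplicities-matched {m = m} {l₂} v@(_ , _ , _ , l₂<l₁ , _) o₁ om o₃
    with k , refl ← odd-gap l₂<l₁ o₁ o₃ | l₂ ≟ k
  ... | yes refl = diagonal-matched l₂ m o₃ om v
  ... | no l₂≢k  = equimultiple-matched l₂ k m o₃ om l₂≢k v

  allOdd-matched : ∀ {l₁ m₁ l₂ m₂} → TwoSize N (l₁ , m₁ , l₂ , m₂) →
                   parity l₁ ≡ O → parity m₁ ≡ O → parity l₂ ≡ O → parity m₂ ≡ O → Matched N (l₁ , m₁ , l₂ , m₂)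
  allOdd-matched {l₁} {m₁} {l₂} {m₂} v@(_ , _ , _ , l₂<l₁ , _) o₁ o₂ o₃ o₄
    with m₁ ≟ m₂ | l₁ ≟ m₂ ×-dec l₂ ≟ m₁
  ... | yes refl  | _                = equal-multiplicities-matched v o₁ o₂ o₃
  ... | no _      | yes (refl , refl) = square-matched l₁ l₂ o₁ o₃ l₂<l₁ v
  ... | no m₁≢m₂ | no not-square     = generic-matched v o₁ o₂ o₃ o₄ m₁≢m₂ not-square

  β-matched : ∀ {q} → TwoSize N q → side q ≡ primal → Matched N q
  β-matched {l₁ , m₁ , l₂ , m₂} v@(_ , _ , _ , l₂<l₁ , area) eq
    with parity l₁ in e₁ | parity m₁ in e₂ | parity l₂ in e₃ | parity m₂ in e₄
  ... | O | O | O | O = allOdd-matched v e₁ e₂ e₃ e₄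
  ... | O | O | O | E with () ← eq
  ... | O | O | E | O with () ← eq
  ... | O | O | E | E with () ← eq
  ... | O | E | O | O with () ← eq
  ... | O | E | O | E with () ← eq
  ... | O | E | E | O with () ← eq
  ... | E | O | O | O with () ← eq
  ... | E | O | O | E with () ← eq
  ... | E | O | E | O with () ← eq
  ... | E | O | E | E with () ← eq
  ... | E | E | O | O with () ← eq
  ... | E | E | E | O with () ← eq
  ... | E | E | E | E with () ← eq
  ... | E | E | O | E
    with a , refl ← even⇒ l₁ e₁ | b , refl ← even⇒ m₁ e₂ | c , refl ← odd⇒ l₂ e₃ | h , refl ← even⇒ m₂ e₄
    with d , refl ← odd⇒ h (half-multiplicity-odd a b (suc (2 * c)) h area) =
    subst (Matched N) (merge-< l₂<l₁) (mixed-matched a b c d (subst (TwoSize N) (sym (merge-< l₂<l₁)) v))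
  ... | O | E | E | E
    with c , refl ← odd⇒ l₁ e₁ | h , refl ← even⇒ m₁ e₂ | a , refl ← even⇒ l₂ e₃ | b , refl ← even⇒ m₂ e₄
    with d , refl ← odd⇒ h (half-multiplicity-odd a b (suc (2 * c)) h (trans (+-comm (2 * a * (2 * b)) _) area)) =
    subst (Matched N) (merge-≤ (<⇒≤ l₂<l₁))
      (mixed-matched a b c d (subst (TwoSize N) (sym (merge-≤ (<⇒≤ l₂<l₁))) v))

  open ℤ₄FromInvolutions (TwoSize N) side conjugate β

  involutions : Involutions
  involutions = record
    { κ-primal     = λ (v , s) → conjugate-twoSize v , trans (side-conjugate v) (cong opposite s)
    ; κ-dual       = λ (v , s) → conjugate-twoSize v , trans (side-conjugate v) (cong opposite s)
    ; κ-involutive = conjugate-involutive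
    ; β-primal     = λ (v , s) → let open Matched (β-matched v s) in image-twoSize , image-primal
    ; β-involutive = λ (v , s) → Matched.involutive (β-matched v s)
    ; β-free       = λ (v , s) → Matched.no-fixed-point (β-matched v s)
    }

  pairedPartitions : List Quad
  pairedPartitions = filter (λ q → isPaired q Bool.≟ true) (twoSizePartitions N)

  ∈-pairedPartitions⁻ : ∀ {q} → q ∈ pairedPartitions → Paired q
  ∈-pairedPartitions⁻ {q} q∈ with q∈ts , ok ← ∈-filter⁻ (λ q → isPaired q Bool.≟ true) q∈
    with paired-true (side q) ok
  ... | inj₁ s = inj₁ (∈-twoSizePartitions⁻ q∈ts , s)
  ... | inj₂ s = inj₂ (∈-twoSizePartitions⁻ q∈ts , s)

  ∈-pairedPartitions⁺ : ∀ {q} → Paired q → q ∈ pairedPartitions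
  ∈-pairedPartitions⁺ (inj₁ (v , s)) = ∈-filter⁺ (λ q → isPaired q Bool.≟ true) (∈-twoSizePartitions⁺ v) (cong paired s)
  ∈-pairedPartitions⁺ (inj₂ (v , s)) = ∈-filter⁺ (λ q → isPaired q Bool.≟ true) (∈-twoSizePartitions⁺ v) (cong paired s)

  4∣#paired : 4 ∣ #[ isPaired ] (twoSizePartitions N)
  4∣#paired = Freeℤ₄Action.4∣length _≟Q_ σ pairedPartitions
    (Unique.filter⁺ _ (Unique.filter⁺ _ (candidates-unique N)))
    (record
      { closed  = ∈-pairedPartitions⁺ ∘ σ-closed involutions ∘ ∈-pairedPartitions⁻
      ; period  = σ⁴ involutions ∘ ∈-pairedPartitions⁻
      ; σ²-free = σ²-free involutions ∘ ∈-pairedPartitions⁻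
      })

lemma3p5 : (N : ℕ) → N % 16 ≡ 14 →
    (count E O O E N + count E E O E N + count O E E E N
      + count O O O O N + count E O E O N + count E E E O N) % 4 ≡ 0
lemma3p5 N N%16≡14 = n∣m⇒m%n≡0 _ 4 (subst (4 ∣_) (sym (six-counts≡ N)) (4∣#paired {N} N%16≡14))
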